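{- Let $(V,E)$ be a hypergraph, $p\in(0,1/2)$, and $t:V\to[0,1)$ an injective birth time assignment. If there are no degenerate edges and no complete conflicting chains with respect to $t$, then the procedure $MGC$ run on input $t$ produces a proper two coloring (no monochromatic edge).
   Context: A hypergraph $(V,E)$ has finite vertex set $V$ and a family $E$ of subsets (edges). Fix $p\in(0,1/2)$ and partition $[0,1)$ into $B=[0,\frac{1-p}{2})$, $P_B=[\frac{1-p}{2},\frac12)$, $R=[\frac12,1-\frac p2)$, $P_R=[1-\frac p2,1)$; regard $[0,1)$ as a circle of unit circumference, so these are arcs. For $v\in V$, $t(v)$ is its birth time; $v$ lies in an interval if $t(v)$ does. An edge $f$ is degenerate if $t[f]\subseteq P_B\cup P_R$, and easy if $t[f]\cap B\ne\emptyset$ and $t[f]\cap R\ne\emptyset$. For an edge $f$ that is neither degenerate nor easy: if $t[f]\cap R=\emptyset$, its first and last vertices are the first and last vertices of $f$ in the clockwise order of the arc $P_R\cup B\cup P_B$ (from $1-p/2$ clockwise through $0$ to $1/2$); if $t[f]\cap B=\emptyset$, they are the first and last in the clockwise order of the arc $P_B\cup R\cup P_R$. Procedure $MGC$ (input: injective $t$ making no edge degenerate): color blue every vertex in $B\cup P_B$ and red every vertex in $R\cup P_R$. Let $b_1,\ldots,b_\alpha$ be the vertices in $P_B$ in increasing order of birth time and $r_1,\ldots,r_\beta$ those in $P_R$ in increasing order of birth time. While the current coloring has a blue edge whose last vertex is in $P_B$ or a red edge whose last vertex is in $P_R$: for $i=1,\ldots,\alpha$, if $b_i$ is the last vertex of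 a currently blue edge, recolor $b_i$ red; then for $i=1,\ldots,\beta$, if $r_i$ is the last vertex of a currently red edge, recolor $r_i$ blue. Return the final coloring. A sequence of edges $(s_1,\ldots,s_r)$ is a chain if $|s_i\cap s_{i+1}|=1$ for $i\in[r-1]$ and the sets $s_i\cap s_{i+1}$ are pairwise disjoint; with $s_i\cap s_{i+1}=\{v_i\}$. A chain is alternating if none of its edges is easy or degenerate, and for each $i\in[r-1]$ the last vertex of $s_{i+1}$ is the first vertex of $s_i$ and $v_i\in P_B\cup P_R$. It is conflicting if it is alternating and the last vertex of $s_1$ lies in $B\cup R$, and complete conflicting if moreover the first vertex of $s_r$ lies in $B\cup R$.
   Formalization: The parameter p and the birth times t(v) take values in the rationals, so $p\in(0,1/2)$ and $t:V\to[0,1)$ range over rational points only. -}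

module Defs where

open import Data.Nat using (ℕ; zero; suc)
open import Data.Fin using (Fin; zero; suc; inject₁; fromℕ; _≟_)
open import Data.Fin.Subset using (Subset; _∈_; _∩_; ⁅_⁆)
open import Data.Fin.Subset.Properties using (_∈?_)
open import Data.Bool using (Bool; true; false; if_then_else_; _∧_; _∨_; not)
open import Data.List using (List; []; _∷_; filter; allFin; foldl)
open import Data.Bool.ListAction using (any; all)
open import Data.List.Membership.Propositional renaming (_∈_ to _∈ₗ_)
open import Data.Maybe using (Maybe; just; nothing)
open import Data.Product using (Σ; _×_; _,_)
open import Data.Sum using (_⊎_)
open import Data.Rational using (ℚ; 0ℚ; 1ℚ; ½; _-_; _*_; _≤ᵇ_)
open import Data.Rational.Properties using (_<?_)
open import Relation.Nullary using (¬_; does)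
open import Relation.Binary.PropositionalEquality using (_≡_)

-- The four arcs B, P_B, R, P_R of [0,1).
data Region : Set where
  inB inPB inR inPR : Region

data Color : Set where
  blue red : Color

_<ᵇ_ : ℚ → ℚ → Bool
x <ᵇ y = does (x <? y)

insertBy : {A : Set} → (A → ℚ) → A → List A → List A
insertBy k x [] = x ∷ []
insertBy k x (y ∷ ys) = if k x ≤ᵇ k y then x ∷ y ∷ ys else y ∷ insertBy k x ys

sortBy : {A : Set} → (A → ℚ) → List A → List A
sortBy k [] = []
sortBy k (x ∷ xs) = insertBy k x (sortBy k xs)

filterᵇ : {A : Set} → (A → Bool) → List A → List A
filterᵇ P [] = []
filterᵇ P (x ∷ xs) = if P x then x ∷ filterᵇ P xs else filterᵇ P xs

argmaxBy : {A : Set} → (A → ℚ) → List A → Maybe A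
argmaxBy k [] = nothing
argmaxBy k (x ∷ xs) with argmaxBy k xs
... | nothing = just x
... | just y = if k y <ᵇ k x then just x else just y

argminBy : {A : Set} → (A → ℚ) → List A → Maybe A
argminBy k [] = nothing
argminBy k (x ∷ xs) with argminBy k xs
... | nothing = just x
... | just y = if k x <ᵇ k y then just x else just y

module Setup (n : ℕ) (p : ℚ) (t : Fin n → ℚ) where

  a₁ a₂ a₃ : ℚ
  a₁ = (1ℚ - p) * ½
  a₂ = ½
  a₃ = 1ℚ - p * ½

  region : ℚ → Region
  region x = if x <ᵇ a₁ then inB else if x <ᵇ a₂ then inPB else if x <ᵇ a₃ then inR else inPR

  Edge : Set
  Edge = Subset n

  InBR : Fin n → Set
  InBR v = (region (t v) ≡ inB) ⊎ (region (t v) ≡ inR)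

  InP : Fin n → Set
  InP v = (region (t v) ≡ inPB) ⊎ (region (t v) ≡ inPR)

  Degenerate : Edge → Set
  Degenerate f = ∀ v → v ∈ f → InP v

  Easy : Edge → Set
  Easy f = (Σ (Fin n) λ v → v ∈ f × region (t v) ≡ inB)
         × (Σ (Fin n) λ v → v ∈ f × region (t v) ≡ inR)

  isReg : Region → Fin n → Bool
  isReg inB v with region (t v)
  ... | inB = true
  ... | _ = false
  isReg inPB v with region (t v)
  ... | inPB = true
  ... | _ = false
  isReg inR v with region (t v)
  ... | inR = true
  ... | _ = false
  isReg inPR v with region (t v)
  ... | inPR = true
  ... | _ = false

  members : Edge → List (Fin n)
  members f = filter (λ v → v ∈? f) (allFin n)

  hasB hasR easyᵇ degenᵇ : Edge → Bool
  hasB f = any (isReg inB) (members f)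
  hasR f = any (isReg inR) (members f)
  easyᵇ f = hasB f ∧ hasR f
  degenᵇ f = not (hasB f ∨ hasR f)

  -- position along the arc P_R ∪ B ∪ P_B, clockwise from 1-p/2 through 0 to 1/2
  keyNoR : Fin n → ℚ
  keyNoR v = if isReg inPR v then t v - 1ℚ else t v

  lastV firstV : Edge → Maybe (Fin n)
  lastV f = if easyᵇ f ∨ degenᵇ f then nothing
            else (if not (hasR f) then argmaxBy keyNoR (members f) else argmaxBy t (members f))
  firstV f = if easyᵇ f ∨ degenᵇ f then nothing
             else (if not (hasR f) then argminBy keyNoR (members f) else argminBy t (members f))

  Coloring : Set
  Coloring = Fin n → Color

  isBlue isRed : Color → Bool
  isBlue blue = true
  isBlue red = false
  isRed c = not (isBlue c)

  update : Coloring → Fin n → Color → Coloring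
  update c v col u = if does (u ≟ v) then col else c u

  allBlue allRed : Coloring → Edge → Bool
  allBlue c f = all (λ v → isBlue (c v)) (members f)
  allRed c f = all (λ v → isRed (c v)) (members f)

  lastIs : Edge → Fin n → Bool
  lastIs f v with lastV f
  ... | nothing = false
  ... | just w = does (w ≟ v)

  lastInPB lastInPR : Edge → Bool
  lastInPB f with lastV f
  ... | nothing = false
  ... | just w = isReg inPB w
  lastInPR f with lastV f
  ... | nothing = false
  ... | just w = isReg inPR w

  module Procedure (E : List Edge) where

    initial : Coloring
    initial v with region (t v)
    ... | inB = blue
    ... | inPB = blue
    ... | inR = red
    ... | inPR = red

    bs rs : List (Fin n)
    bs = sortBy t (filterᵇ (isReg inPB) (allFin n))
    rs = sortBy t (filterᵇ (isReg inPR) (allFin n))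

    guard : Coloring → Bool
    guard c = any (λ f → (allBlue c f ∧ lastInPB f) ∨ (allRed c f ∧ lastInPR f)) E

    stepB : Coloring → Fin n → Coloring
    stepB c b = if any (λ f → allBlue c f ∧ lastIs f b) E then update c b red else c

    stepR : Coloring → Fin n → Coloring
    stepR c r = if any (λ f → allRed c f ∧ lastIs f r) E then update c r blue else c

    body : Coloring → Coloring
    body c = foldl stepR (foldl stepB c bs) rs

    loop : ℕ → Coloring → Coloring
    loop zero c = c
    loop (suc k) c = if guard c then loop k (body c) else c

    -- each non-final iteration recolours some vertex, and every vertex is
    -- recoloured at most once, so n+1 rounds suffice
    MGC : Coloring
    MGC = loop (suc n) initial

  -- chains (s₁,…,s_r), r = k+1, with s_i ∩ s_{i+1} = {v_i} and the v_i distinct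
  record Chain (E : List Edge) : Set where
    field
      k : ℕ
      s : Fin (suc k) → Edge
      v : Fin k → Fin n
      s∈E : ∀ i → s i ∈ₗ E
      meet : ∀ i → s (inject₁ i) ∩ s (suc i) ≡ ⁅ v i ⁆
      distinct : ∀ i j → v i ≡ v j → i ≡ j

  module _ {E : List Edge} (ch : Chain E) where
    open Chain ch

    Alternating : Set
    Alternating = (∀ i → ¬ Easy (s i) × ¬ Degenerate (s i))
                × (∀ i → lastV (s (suc i)) ≡ firstV (s (inject₁ i)) × InP (v i))

    Conflicting : Set
    Conflicting = Alternating × Σ (Fin n) λ w → lastV (s zero) ≡ just w × InBR w

    CompleteConflicting : Set
    CompleteConflicting = Conflicting × Σ (Fin n) λ w → firstV (s (fromℕ k)) ≡ just w × InBR w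

  Monochromatic : Coloring → Edge → Set
  Monochromatic c f = Σ Color λ col → ∀ v → v ∈ f → c v ≡ col

  Proper : List Edge → Coloring → Set
  Proper E c = ∀ f → f ∈ₗ E → ¬ Monochromatic c f

-- A run of MGC is recorded as the list of its recolourings, each with the edge that
-- triggered it.  Vertices of B ∪ R are never recoloured, and a recoloured vertex is a
-- pole vertex that was the last vertex of an edge monochromatic in its original colour.
-- Hence an edge f that is monochromatic, say blue, at the end avoids R, so it lies on one
-- arc, and as the loop has stopped its last vertex is in B ∪ R.  If the first vertex u of f
-- is in P_R, then u was recoloured because of an earlier red edge g with last vertex u; a
-- vertex of f ∩ g changed colour between the two moments, so it is a P_R vertex, and the
-- orders on f and g pin it down to u.  Prepending f to the chain obtained from g (by
-- induction on the length of the run) gives a complete conflicting chain.  Every round of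
-- the loop recolours a new vertex, so n + 1 rounds suffice.
module Submission where

open import Defs
open import Data.Nat using (ℕ)
open import Data.Fin using (Fin)
open import Data.Fin.Subset using (Subset)
open import Data.List using (List)
open import Data.List.Membership.Propositional using (_∈_)
open import Data.Product using (_×_)
open import Data.Rational using (ℚ; 0ℚ; 1ℚ; ½; _≤_; _<_)
open import Relation.Nullary using (¬_)
open import Relation.Binary.PropositionalEquality using (_≡_)

open import Data.Bool using (Bool; true; false; T; if_then_else_; _∧_; _∨_; not)
open import Data.Bool.ListAction using (any; all)
open import Data.Bool.Properties using (T-≡; T-∧; T-∨; ¬-not)
open import Data.Empty using (⊥-elim)
open import Data.Fin using (zero; suc; _≟_; inject₁; fromℕ)
open import Data.Fin.Subset using (⁅_⁆; _∩_; _∪_; _⊆_; ∣_∣) renaming (⊥ to ∅; _∈_ to _∈ₛ_; _∉_ to _∉ₛ_)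
open import Data.Fin.Subset.Properties
  using (_∈?_; x∈⁅x⁆; x∈⁅y⁆⇒x≡y; x∈p∩q⁺; x∈p∩q⁻; x∈p∪q⁺; x∈p∪q⁻; q⊆p∪q; ⊆-antisym; ∉⊥
        ; ∣p∣≤n; p⊂q⇒∣p∣<∣q∣)
open import Data.List using ([]; _∷_; allFin; filter; foldl; length)
open import Data.List.Membership.Propositional using (find; lose)
open import Data.List.Membership.Propositional.Properties using (∈-filter⁺; ∈-filter⁻; ∈-allFin)
open import Data.List.Relation.Binary.Permutation.Propositional using (_↭_; ↭-refl; ↭-prep; ↭-swap; ↭-trans; ↭-sym)
open import Data.List.Relation.Binary.Permutation.Propositional.Properties using (∈-resp-↭)
open import Data.List.Relation.Unary.All as All using ()
open import Data.List.Relation.Unary.All.Properties using (all⁺; all⁻)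
open import Data.List.Relation.Unary.Any using (here; there; any?)
open import Data.List.Relation.Unary.Any.Properties using (any⁺; any⁻)
open import Data.Maybe using (just; nothing)
open import Data.Nat using (zero; suc; z≤n; s≤s)
import Data.Nat as ℕ
open import Data.Nat.Induction using (<-wellFounded)
import Data.Nat.Properties as ℕₚ
open import Data.Product using (∃; ∃₂; _,_; proj₁; proj₂)
open import Data.Rational using (_+_; -_; _-_; _≤ᵇ_)
open import Data.Rational.Properties
  using (_<?_; ≤-refl; <⇒≤; ≮⇒≥; ≤-<-trans; <-≤-trans; <-irrefl; ≤-antisym
        ; +-monoˡ-<; +-identityʳ; +-inverseʳ; module ≤-Reasoning)
open import Data.Sum using (_⊎_; inj₁; inj₂; [_,_]′; swap)
open import Function using (id; _∘_; case_of_)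
open import Function.Bundles using (Equivalence)
open import Induction.WellFounded using (Acc; acc)
open import Relation.Binary.PropositionalEquality using (refl; sym; trans; cong; cong-app; subst; subst₂; _≢_)
open import Relation.Nullary using (Dec; does; yes; no)
open import Relation.Nullary.Decidable using (T?; dec-true)
open import Relation.Nullary.Reflects using (Reflects; ofʸ; ofⁿ)

-- With-abstraction cannot find a test x <? y on ℚ once it is unfolded, so such tests are split via this view.
ifᵈ-view : {P A : Set} (d : Dec P) {x y : A} →
           (P × (if does d then x else y) ≡ x) ⊎ (¬ P × (if does d then x else y) ≡ y)
ifᵈ-view (yes p) = inj₁ (p , refl)
ifᵈ-view (no ¬p) = inj₂ (¬p , refl)

∩≡⁅⁆ : ∀ {n} {p q : Subset n} {u} → u ∈ₛ p → u ∈ₛ q → (∀ {x} → x ∈ₛ p → x ∈ₛ q → x ≡ u) →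
       p ∩ q ≡ ⁅ u ⁆
∩≡⁅⁆ {p = p} {q} {u} u∈p u∈q only = ⊆-antisym
  (λ x∈p∩q → let x∈p , x∈q = x∈p∩q⁻ p q x∈p∩q
             in subst (_∈ₛ ⁅ u ⁆) (sym (only x∈p x∈q)) (x∈⁅x⁆ u))
  (λ x∈⁅u⁆ → subst (_∈ₛ p ∩ q) (sym (x∈⁅y⁆⇒x≡y u x∈⁅u⁆)) (x∈p∩q⁺ (u∈p , u∈q)))

module _ {A : Set} where

  filterᵇ-≡ : (P : A → Bool) (xs : List A) → filterᵇ P xs ≡ filter (T? ∘ P) xs
  filterᵇ-≡ P [] = refl
  filterᵇ-≡ P (x ∷ xs) with P x
  ... | true  = cong (x ∷_) (filterᵇ-≡ P xs)
  ... | false = filterᵇ-≡ P xs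

  ∈-filterᵇ⁺ : ∀ (P : A → Bool) {x xs} → x ∈ xs → T (P x) → x ∈ filterᵇ P xs
  ∈-filterᵇ⁺ P {xs = xs} x∈xs px = subst (_ ∈_) (sym (filterᵇ-≡ P xs)) (∈-filter⁺ (T? ∘ P) x∈xs px)

  ∈-filterᵇ⁻ : ∀ (P : A → Bool) {x} xs → x ∈ filterᵇ P xs → T (P x)
  ∈-filterᵇ⁻ P xs x∈ = proj₂ (∈-filter⁻ (T? ∘ P) {xs = xs} (subst (_ ∈_) (filterᵇ-≡ P xs) x∈))

  module _ (k : A → ℚ) where

    insertBy-↭ : ∀ x ys → insertBy k x ys ↭ x ∷ ys
    insertBy-↭ x [] = ↭-refl
    insertBy-↭ x (y ∷ ys) with k x ≤ᵇ k y
    ... | true  = ↭-refl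
    ... | false = ↭-trans (↭-prep y (insertBy-↭ x ys)) (↭-swap y x ↭-refl)

    sortBy-↭ : ∀ xs → sortBy k xs ↭ xs
    sortBy-↭ [] = ↭-refl
    sortBy-↭ (x ∷ xs) = ↭-trans (insertBy-↭ x (sortBy k xs)) (↭-prep x (sortBy-↭ xs))

    argmaxBy-nonempty : ∀ {x xs} → x ∈ xs → ∃ λ m → argmaxBy k xs ≡ just m
    argmaxBy-nonempty {xs = x ∷ xs} _ with argmaxBy k xs
    ... | nothing = x , refl
    ... | just y with ifᵈ-view (k y <? k x) {just x} {just y}
    ...   | inj₁ (_ , eq) = x , eq
    ...   | inj₂ (_ , eq) = y , eq

    argmaxBy-maximal : ∀ xs {m} → argmaxBy k xs ≡ just m → m ∈ xs × (∀ {z} → z ∈ xs → k z ≤ k m)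
    argmaxBy-maximal (x ∷ xs) eq with argmaxBy k xs in e
    argmaxBy-maximal (x ∷ []) refl | nothing = here refl , λ { (here refl) → ≤-refl }
    argmaxBy-maximal (x ∷ y ∷ xs) refl | nothing
      with () ← trans (sym e) (proj₂ (argmaxBy-nonempty (here {xs = xs} refl)))
    ... | just y with argmaxBy-maximal xs e | ifᵈ-view (k y <? k x) {just x} {just y}
    ...   | y∈xs , y-max | inj₁ (y<x , eq′) with refl ← trans (sym eq′) eq =
            here refl , λ { (here refl) → ≤-refl ; (there z∈xs) → <⇒≤ (≤-<-trans (y-max z∈xs) y<x) }
    ...   | y∈xs , y-max | inj₂ (y≮x , eq′) with refl ← trans (sym eq′) eq =
            there y∈xs , λ { (here refl) → ≮⇒≥ y≮x ; (there z∈xs) → y-max z∈xs }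

    argminBy-nonempty : ∀ {x xs} → x ∈ xs → ∃ λ m → argminBy k xs ≡ just m
    argminBy-nonempty {xs = x ∷ xs} _ with argminBy k xs
    ... | nothing = x , refl
    ... | just y with ifᵈ-view (k x <? k y) {just x} {just y}
    ...   | inj₁ (_ , eq) = x , eq
    ...   | inj₂ (_ , eq) = y , eq

    argminBy-minimal : ∀ xs {m} → argminBy k xs ≡ just m → m ∈ xs × (∀ {z} → z ∈ xs → k m ≤ k z)
    argminBy-minimal (x ∷ xs) eq with argminBy k xs in e
    argminBy-minimal (x ∷ []) refl | nothing = here refl , λ { (here refl) → ≤-refl }
    argminBy-minimal (x ∷ y ∷ xs) refl | nothing
      with () ← trans (sym e) (proj₂ (argminBy-nonempty (here {xs = xs} refl)))
    ... | just y with argminBy-minimal xs e | ifᵈ-view (k x <? k y) {just x} {just y}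
    ...   | y∈xs , y-min | inj₁ (x<y , eq′) with refl ← trans (sym eq′) eq =
            here refl , λ { (here refl) → ≤-refl ; (there z∈xs) → <⇒≤ (<-≤-trans x<y (y-min z∈xs)) }
    ...   | y∈xs , y-min | inj₂ (x≮y , eq′) with refl ← trans (sym eq′) eq =
            there y∈xs , λ { (here refl) → ≮⇒≥ x≮y ; (there z∈xs) → y-min z∈xs }

opposite : Color → Color
opposite blue = red
opposite red  = blue

opposite-≢ : ∀ X → opposite X ≢ X
opposite-≢ blue ()
opposite-≢ red  ()

core pole : Color → Region
core blue = inB
core red  = inR
pole blue = inPB
pole red  = inPR

core≢pole : ∀ {X Y} → core X ≢ pole Y
core≢pole {blue} {blue} ()
core≢pole {blue} {red}  ()
core≢pole {red}  {blue} ()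
core≢pole {red}  {red}  ()

data Side (X : Color) (r : Region) : Set where
  own-core   : r ≡ core X → Side X r
  own-pole   : r ≡ pole X → Side X r
  other-core : r ≡ core (opposite X) → Side X r
  other-pole : r ≡ pole (opposite X) → Side X r

side : ∀ X r → Side X r
side blue inB  = own-core refl
side blue inPB = own-pole refl
side blue inR  = other-core refl
side blue inPR = other-pole refl
side red  inB  = other-core refl
side red  inPB = other-pole refl
side red  inR  = own-core refl
side red  inPR = own-pole refl

data Consecutive : Region → Region → Set where
  B→PB : Consecutive inB inPB
  PB→R : Consecutive inPB inR
  R→PR : Consecutive inR inPR

module Arcs (n : ℕ) (p : ℚ) (t : Fin n → ℚ) where
  open Setup n p t public

  data Bounds (x : ℚ) : Region → Set where
    B  : x < a₁ → Bounds x inB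
    PB : a₁ ≤ x → x < a₂ → Bounds x inPB
    R  : a₂ ≤ x → x < a₃ → Bounds x inR
    PR : a₃ ≤ x → Bounds x inPR

  bounds : ∀ x → Bounds x (region x)
  bounds x = decide (x <? a₁) (x <? a₂) (x <? a₃)
    where
    decide : (d₁ : Dec (x < a₁)) (d₂ : Dec (x < a₂)) (d₃ : Dec (x < a₃)) →
             Bounds x (if does d₁ then inB else if does d₂ then inPB else if does d₃ then inR else inPR)
    decide (yes x<a₁) _          _          = B x<a₁
    decide (no x≮a₁)  (yes x<a₂) _          = PB (≮⇒≥ x≮a₁) x<a₂
    decide (no _)     (no x≮a₂)  (yes x<a₃) = R (≮⇒≥ x≮a₂) x<a₃
    decide (no _)     (no _)     (no x≮a₃)  = PR (≮⇒≥ x≮a₃)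

  region-< : ∀ {r r′ x y} → Consecutive r r′ → region x ≡ r → region y ≡ r′ → x < y
  region-< {x = x} {y} c refl refl = go c (bounds x) (bounds y)
    where
    go : ∀ {r r′} → Consecutive r r′ → Bounds x r → Bounds y r′ → x < y
    go B→PB (B x<a₁)    (PB a₁≤y _) = <-≤-trans x<a₁ a₁≤y
    go PB→R (PB _ x<a₂) (R a₂≤y _)  = <-≤-trans x<a₂ a₂≤y
    go R→PR (R _ x<a₃)  (PR a₃≤y)   = <-≤-trans x<a₃ a₃≤y

  isReg-reflects : ∀ r v → Reflects (region (t v) ≡ r) (isReg r v)
  isReg-reflects inB v with region (t v)
  ... | inB  = ofʸ refl
  ... | inPB = ofⁿ λ ()
  ... | inR  = ofⁿ λ ()
  ... | inPR = ofⁿ λ ()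
  isReg-reflects inPB v with region (t v)
  ... | inB  = ofⁿ λ ()
  ... | inPB = ofʸ refl
  ... | inR  = ofⁿ λ ()
  ... | inPR = ofⁿ λ ()
  isReg-reflects inR v with region (t v)
  ... | inB  = ofⁿ λ ()
  ... | inPB = ofⁿ λ ()
  ... | inR  = ofʸ refl
  ... | inPR = ofⁿ λ ()
  isReg-reflects inPR v with region (t v)
  ... | inB  = ofⁿ λ ()
  ... | inPB = ofⁿ λ ()
  ... | inR  = ofⁿ λ ()
  ... | inPR = ofʸ refl

  isReg-sound : ∀ {r v} → T (isReg r v) → region (t v) ≡ r
  isReg-sound {r} {v} with isReg r v | isReg-reflects r v
  ... | true  | ofʸ e = λ _ → e
  ... | false | ofⁿ _ = λ ()

  isReg-complete : ∀ {r v} → region (t v) ≡ r → T (isReg r v)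
  isReg-complete {r} {v} with isReg r v | isReg-reflects r v
  ... | true  | ofʸ _  = λ _ → _
  ... | false | ofⁿ ¬e = ¬e

  ∈-members⁺ : ∀ {f v} → v ∈ₛ f → v ∈ members f
  ∈-members⁺ {f} {v} v∈f = ∈-filter⁺ (_∈? f) (∈-allFin v) v∈f

  ∈-members⁻ : ∀ {f v} → v ∈ members f → v ∈ₛ f
  ∈-members⁻ {f} v∈ = proj₂ (∈-filter⁻ (_∈? f) {xs = allFin n} v∈)

  hasRegion : Region → Edge → Bool
  hasRegion r f = any (isReg r) (members f)

  hasRegion-true : ∀ {r f v} → v ∈ₛ f → region (t v) ≡ r → hasRegion r f ≡ true
  hasRegion-true v∈f e = Equivalence.to T-≡ (any⁺ _ (lose (∈-members⁺ v∈f) (isReg-complete e)))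

  hasRegion-false : ∀ {r f} → (∀ {v} → v ∈ₛ f → region (t v) ≢ r) → hasRegion r f ≡ false
  hasRegion-false {r} {f} avoid = ¬-not λ has →
    let v , v∈ , is-r = find (any⁻ _ (members f) (Equivalence.from T-≡ has))
    in avoid (∈-members⁻ v∈) (isReg-sound is-r)

  arcKey : Color → Fin n → ℚ
  arcKey blue = keyNoR
  arcKey red  = t

  offset : Color → Region → ℚ
  offset blue inPR = - 1ℚ
  offset _    _    = 0ℚ

  arcKey-offset : ∀ X v → arcKey X v ≡ t v + offset X (region (t v))
  arcKey-offset red v = sym (+-identityʳ (t v))
  arcKey-offset blue v with region (t v)
  ... | inB  = sym (+-identityʳ (t v))
  ... | inPB = sym (+-identityʳ (t v))
  ... | inR  = sym (+-identityʳ (t v))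
  ... | inPR = refl

  arcKey-at : ∀ X {v r} → region (t v) ≡ r → arcKey X v ≡ t v + offset X r
  arcKey-at X {v} refl = arcKey-offset X v

  arcKey-< : ∀ X {a b r r′} → region (t a) ≡ r → region (t b) ≡ r′ → offset X r ≡ offset X r′ →
             t a < t b → arcKey X a < arcKey X b
  arcKey-< X {a} {b} {r} {r′} ea eb same a<b =
    subst₂ _<_ (sym (arcKey-at X ea)) (sym (arcKey-at X eb))
      (subst (λ o → t a + o < t b + offset X r′) (sym same) (+-monoˡ-< (offset X r′) a<b))

  arcKey-≤⇒t-≤ : ∀ X {a b} → region (t a) ≡ region (t b) → arcKey X a ≤ arcKey X b → t a ≤ t b
  arcKey-≤⇒t-≤ X same ka≤kb = ≮⇒≥ λ b<a →
    <-irrefl refl (<-≤-trans (arcKey-< X (sym same) refl refl b<a) ka≤kb)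

  core-before-pole : ∀ X {a b} → region (t a) ≡ core X → region (t b) ≡ pole X → arcKey X a < arcKey X b
  core-before-pole blue ea eb = arcKey-< blue ea eb refl (region-< B→PB ea eb)
  core-before-pole red  ea eb = arcKey-< red ea eb refl (region-< R→PR ea eb)

  pole-before-core : (∀ v → 0ℚ ≤ t v × t v < 1ℚ) →
                     ∀ X {a b} → region (t a) ≡ pole (opposite X) → region (t b) ≡ core X → arcKey X a < arcKey X b
  pole-before-core _       red  ea eb = region-< PB→R ea eb
  pole-before-core 0≤t<1 blue {a} {b} ea eb = begin-strict
    arcKey blue a  ≡⟨ arcKey-at blue ea ⟩
    t a - 1ℚ       <⟨ +-monoˡ-< (- 1ℚ) (proj₂ (0≤t<1 a)) ⟩
    1ℚ - 1ℚ        ≡⟨ +-inverseʳ 1ℚ ⟩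
    0ℚ             ≤⟨ proj₁ (0≤t<1 b) ⟩
    t b            ≡⟨ sym (+-identityʳ (t b)) ⟩
    t b + 0ℚ       ≡⟨ sym (arcKey-at blue eb) ⟩
    arcKey blue b  ∎
    where open ≤-Reasoning

  OnArc : Color → Edge → Set
  OnArc X f = (∃ λ b → b ∈ₛ f × region (t b) ≡ core X) × (∀ {v} → v ∈ₛ f → region (t v) ≢ core (opposite X))

  OnArc⇒¬Easy : ∀ {X f} → OnArc X f → ¬ Easy f
  OnArc⇒¬Easy {blue} (_ , avoid) (_ , (_ , v∈f , vR)) = avoid v∈f vR
  OnArc⇒¬Easy {red}  (_ , avoid) ((_ , v∈f , vB) , _) = avoid v∈f vB

  firstV-onArc : ∀ {X f} → OnArc X f → firstV f ≡ argminBy (arcKey X) (members f)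
  firstV-onArc {blue} ((_ , b∈f , bB) , avoid) rewrite hasRegion-true b∈f bB | hasRegion-false avoid = refl
  firstV-onArc {red}  ((_ , b∈f , bR) , avoid) rewrite hasRegion-true b∈f bR | hasRegion-false avoid = refl

  lastV-onArc : ∀ {X f} → OnArc X f → lastV f ≡ argmaxBy (arcKey X) (members f)
  lastV-onArc {blue} ((_ , b∈f , bB) , avoid) rewrite hasRegion-true b∈f bB | hasRegion-false avoid = refl
  lastV-onArc {red}  ((_ , b∈f , bR) , avoid) rewrite hasRegion-true b∈f bR | hasRegion-false avoid = refl

  firstV-exists : ∀ {X f} → OnArc X f → ∃ λ u → firstV f ≡ just u
  firstV-exists {X} arc@((_ , b∈f , _) , _) =
    subst (λ m → ∃ λ u → m ≡ just u) (sym (firstV-onArc arc)) (argminBy-nonempty (arcKey X) (∈-members⁺ b∈f))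

  lastV-exists : ∀ {X f} → OnArc X f → ∃ λ w → lastV f ≡ just w
  lastV-exists {X} arc@((_ , b∈f , _) , _) =
    subst (λ m → ∃ λ w → m ≡ just w) (sym (lastV-onArc arc)) (argmaxBy-nonempty (arcKey X) (∈-members⁺ b∈f))

  firstV-minimal : ∀ {X f u} → OnArc X f → firstV f ≡ just u →
                   u ∈ₛ f × (∀ {z} → z ∈ₛ f → arcKey X u ≤ arcKey X z)
  firstV-minimal {X} {f} arc first =
    let u∈ , u-min = argminBy-minimal (arcKey X) (members f) (trans (sym (firstV-onArc arc)) first)
    in ∈-members⁻ u∈ , u-min ∘ ∈-members⁺

  lastV-∈ : ∀ {f w} → lastV f ≡ just w → w ∈ₛ f
  lastV-∈ {f} last with easyᵇ f ∨ degenᵇ f | not (hasR f)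
  lastV-∈ {f} () | true | _
  ... | false | true  = ∈-members⁻ (proj₁ (argmaxBy-maximal keyNoR (members f) last))
  ... | false | false = ∈-members⁻ (proj₁ (argmaxBy-maximal t (members f) last))

  lastV-maximal : ∀ {X f w} → OnArc X f → lastV f ≡ just w →
                  w ∈ₛ f × (∀ {z} → z ∈ₛ f → arcKey X z ≤ arcKey X w)
  lastV-maximal {X} {f} arc last =
    let w∈ , w-max = argmaxBy-maximal (arcKey X) (members f) (trans (sym (lastV-onArc arc)) last)
    in ∈-members⁻ w∈ , w-max ∘ ∈-members⁺

  firstV-region : ∀ {X f u} → OnArc X f → firstV f ≡ just u →
                  region (t u) ≡ core X ⊎ region (t u) ≡ pole (opposite X)
  firstV-region {X} {u = u} arc@((_ , b∈f , bcore) , avoid) first = case side X (region (t u)) of λ where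
      (own-core   e) → inj₁ e
      (other-pole e) → inj₂ e
      (other-core e) → ⊥-elim (avoid u∈f e)
      (own-pole   e) → ⊥-elim (<-irrefl refl (<-≤-trans (core-before-pole X bcore e) (u-min b∈f)))
    where
    u∈f = proj₁ (firstV-minimal arc first)
    u-min = proj₂ (firstV-minimal arc first)

  lastV-region : (∀ v → 0ℚ ≤ t v × t v < 1ℚ) → ∀ {X f w} → OnArc X f → lastV f ≡ just w →
                 region (t w) ≡ core X ⊎ region (t w) ≡ pole X
  lastV-region 0≤t<1 {X} {w = w} arc@((_ , b∈f , bcore) , avoid) last = case side X (region (t w)) of λ where
      (own-core   e) → inj₁ e
      (own-pole   e) → inj₂ e
      (other-core e) → ⊥-elim (avoid w∈f e)
      (other-pole e) → ⊥-elim (<-irrefl refl (<-≤-trans (pole-before-core 0≤t<1 X e bcore) (w-max b∈f)))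
    where
    w∈f = proj₁ (lastV-maximal arc last)
    w-max = proj₂ (lastV-maximal arc last)

  pole⇒InP : ∀ {X v} → region (t v) ≡ pole X → InP v
  pole⇒InP {blue} = inj₁
  pole⇒InP {red}  = inj₂

  core⇒InBR : ∀ {X v} → region (t v) ≡ core X → InBR v
  core⇒InBR {blue} = inj₁
  core⇒InBR {red}  = inj₂

  core⇒¬InP : ∀ {X v} → region (t v) ≡ core X → ¬ InP v
  core⇒¬InP e (inj₁ e′) = core≢pole (trans (sym e) e′)
  core⇒¬InP e (inj₂ e′) = core≢pole (trans (sym e) e′)

  InBR⇒core : ∀ X {v} → InBR v → region (t v) ≡ core X ⊎ region (t v) ≡ core (opposite X)
  InBR⇒core blue = id
  InBR⇒core red  = swap

  InBR⊎InP : ∀ v → InBR v ⊎ InP v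
  InBR⊎InP v with region (t v)
  ... | inB  = inj₁ (inj₁ refl)
  ... | inPB = inj₂ (inj₁ refl)
  ... | inR  = inj₁ (inj₂ refl)
  ... | inPR = inj₂ (inj₂ refl)

  InBR? : ∀ v → Dec (InBR v)
  InBR? v with InBR⊎InP v
  ... | inj₁ core = yes core
  ... | inj₂ p    = no λ where (inj₁ e) → core⇒¬InP {blue} e p
                               (inj₂ e) → core⇒¬InP {red} e p

  nondegenerate⇒InBR : ∀ {f} → ¬ Degenerate f → ∃ λ v → v ∈ₛ f × InBR v
  nondegenerate⇒InBR {f} nondeg with any? InBR? (members f)
  ... | yes some = let v , v∈ , core = find some in v , ∈-members⁻ v∈ , core
  ... | no none  = ⊥-elim (nondeg λ v v∈f →
    [ (λ core → ⊥-elim (none (lose (∈-members⁺ v∈f) core))) , id ]′ (InBR⊎InP v))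

module Chains (n : ℕ) (p : ℚ) (t : Fin n → ℚ) (E : List (Subset n)) where
  open Setup n p t

  singleton : ∀ {f} → f ∈ E → Chain E
  singleton {f} f∈E = record { k = 0 ; s = λ _ → f ; v = λ () ; s∈E = λ _ → f∈E ; meet = λ () ; distinct = λ () }

  singleton-alternating : ∀ {f} (f∈E : f ∈ E) → ¬ Easy f → ¬ Degenerate f → Alternating (singleton f∈E)
  singleton-alternating _ ¬easy ¬degenerate = (λ _ → ¬easy , ¬degenerate) , λ ()

  cons : ∀ {f u} → f ∈ E → (ch : Chain E) → f ∩ Chain.s ch zero ≡ ⁅ u ⁆ → (∀ i → Chain.v ch i ≢ u) → Chain E
  cons {f} {u} f∈E ch f∩s₀ fresh = record
    { k = suc k ; s = s′ ; v = v′ ; s∈E = s′∈E ; meet = meet′ ; distinct = distinct′ }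
    where
    open Chain ch
    s′ : Fin (suc (suc k)) → Edge
    s′ zero    = f
    s′ (suc i) = s i
    v′ : Fin (suc k) → Fin n
    v′ zero    = u
    v′ (suc i) = v i
    s′∈E : ∀ i → s′ i ∈ E
    s′∈E zero    = f∈E
    s′∈E (suc i) = s∈E i
    meet′ : ∀ i → s′ (inject₁ i) ∩ s′ (suc i) ≡ ⁅ v′ i ⁆
    meet′ zero    = f∩s₀
    meet′ (suc i) = meet i
    distinct′ : ∀ i j → v′ i ≡ v′ j → i ≡ j
    distinct′ zero    zero    _   = refl
    distinct′ zero    (suc j) u≡v = ⊥-elim (fresh j (sym u≡v))
    distinct′ (suc i) zero    v≡u = ⊥-elim (fresh i v≡u)
    distinct′ (suc i) (suc j) v≡v = cong suc (distinct i j v≡v)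

  cons-alternating : ∀ {f u} (f∈E : f ∈ E) ch f∩s₀ fresh → ¬ Easy f → ¬ Degenerate f →
                     lastV (Chain.s ch zero) ≡ firstV f → InP u → Alternating ch →
                     Alternating (cons {f} {u} f∈E ch f∩s₀ fresh)
  cons-alternating _ _ _ _ ¬easy ¬degenerate link u∈P (edges , links) =
    (λ { zero → ¬easy , ¬degenerate ; (suc i) → edges i }) ,
    (λ { zero → link , u∈P ; (suc i) → links i })

module Runs (n : ℕ) (p : ℚ) (t : Fin n → ℚ) (E : List (Subset n)) where
  open Arcs n p t
  open Procedure E

  initial-core : ∀ {X v} → region (t v) ≡ core X → initial v ≡ X
  initial-core {blue} e rewrite e = refl
  initial-core {red}  e rewrite e = refl

  initial-pole : ∀ {X v} → region (t v) ≡ pole X → initial v ≡ X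
  initial-pole {blue} e rewrite e = refl
  initial-pole {red}  e rewrite e = refl

  InP-initial⇒pole : ∀ {X v} → InP v → initial v ≡ X → region (t v) ≡ pole X
  InP-initial⇒pole {v = v} (inj₁ e) iv = subst (λ Y → region (t v) ≡ pole Y) (trans (sym (initial-pole {blue} e)) iv) e
  InP-initial⇒pole {v = v} (inj₂ e) iv = subst (λ Y → region (t v) ≡ pole Y) (trans (sym (initial-pole {red} e)) iv) e

  Mono : Color → Coloring → Edge → Set
  Mono X c f = ∀ {v} → v ∈ₛ f → c v ≡ X

  update-view : ∀ c v col u → (u ≡ v × update c v col u ≡ col) ⊎ (u ≢ v × update c v col u ≡ c u)
  update-view c v col u = ifᵈ-view (u ≟ v)

  update-preserves : ∀ c v {col u} → c u ≡ col → update c v col u ≡ col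
  update-preserves c v {col} {u} cu≡col = [ proj₂ , (λ (_ , eq) → trans eq cu≡col) ]′ (update-view c v col u)

  Recolouring : Set
  Recolouring = Fin n × Edge

  colouring : List Recolouring → Coloring
  colouring []            = initial
  colouring ((v , _) ∷ σ) = update (colouring σ) v (opposite (initial v))

  recoloured : List Recolouring → Subset n
  recoloured []            = ∅
  recoloured ((v , _) ∷ σ) = ⁅ v ⁆ ∪ recoloured σ

  colouring-recoloured : ∀ σ {x} → x ∈ₛ recoloured σ → colouring σ x ≡ opposite (initial x)
  colouring-recoloured [] x∈∅ = ⊥-elim (∉⊥ x∈∅)
  colouring-recoloured ((v , _) ∷ σ) {x} x∈ with update-view (colouring σ) v (opposite (initial v)) x
  ... | inj₁ (refl , eq) = eq
  ... | inj₂ (x≢v , eq) with x∈p∪q⁻ ⁅ v ⁆ (recoloured σ) x∈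
  ...   | inj₁ x∈⁅v⁆ = ⊥-elim (x≢v (x∈⁅y⁆⇒x≡y v x∈⁅v⁆))
  ...   | inj₂ x∈σ   = trans eq (colouring-recoloured σ x∈σ)

  colouring-unrecoloured : ∀ σ {x} → x ∉ₛ recoloured σ → colouring σ x ≡ initial x
  colouring-unrecoloured [] _ = refl
  colouring-unrecoloured ((v , _) ∷ σ) {x} x∉ with update-view (colouring σ) v (opposite (initial v)) x
  ... | inj₁ (refl , _) = ⊥-elim (x∉ (x∈p∪q⁺ (inj₁ (x∈⁅x⁆ x))))
  ... | inj₂ (_ , eq)   = trans eq (colouring-unrecoloured σ (x∉ ∘ x∈p∪q⁺ ∘ inj₂))

  recoloured-complete : ∀ σ {x} → colouring σ x ≢ initial x → x ∈ₛ recoloured σ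
  recoloured-complete [] changed = ⊥-elim (changed refl)
  recoloured-complete ((v , _) ∷ σ) {x} changed with update-view (colouring σ) v (opposite (initial v)) x
  ... | inj₁ (refl , _) = x∈p∪q⁺ (inj₁ (x∈⁅x⁆ x))
  ... | inj₂ (_ , eq)   = x∈p∪q⁺ (inj₂ (recoloured-complete σ (changed ∘ trans eq)))

  recoloured-of-colour : ∀ σ {x X} → colouring σ x ≡ X → initial x ≡ opposite X → x ∈ₛ recoloured σ
  recoloured-of-colour σ {X = X} colour-x initial-x =
    recoloured-complete σ λ unchanged → opposite-≢ X (trans (sym initial-x) (trans (sym unchanged) colour-x))

  recoloured-between : ∀ {σ₁ σ₂ x} → recoloured σ₁ ⊆ recoloured σ₂ → colouring σ₁ x ≢ colouring σ₂ x →
                       colouring σ₁ x ≡ initial x × x ∈ₛ recoloured σ₂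
  recoloured-between {σ₁} {σ₂} {x} σ₁⊆σ₂ differ with x ∈? recoloured σ₁
  ... | yes x∈σ₁ =
    ⊥-elim (differ (trans (colouring-recoloured σ₁ x∈σ₁) (sym (colouring-recoloured σ₂ (σ₁⊆σ₂ x∈σ₁)))))
  ... | no  x∉σ₁ = unchanged , recoloured-complete σ₂ (λ eq → differ (trans unchanged (sym eq)))
    where
    unchanged = colouring-unrecoloured σ₁ x∉σ₁

  record Justified (σ : List Recolouring) (v : Fin n) (g : Edge) : Set where
    field
      in-P   : InP v
      edge∈E : g ∈ E
      last   : lastV g ≡ just v
      mono   : Mono (initial v) (colouring σ) g

  data Run : List Recolouring → Set where
    []  : Run []
    _∷_ : ∀ {σ v g} → Justified σ v g → Run σ → Run ((v , g) ∷ σ)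

  justified-fresh : ∀ {σ v g} → Justified σ v g → v ∉ₛ recoloured σ
  justified-fresh {σ} {v} j v∈σ =
    opposite-≢ (initial v) (trans (sym (colouring-recoloured σ v∈σ)) (Justified.mono j (lastV-∈ (Justified.last j))))

  record Justification (σ : List Recolouring) (x : Fin n) : Set where
    field
      {earlier}    : List Recolouring
      {reason}     : Edge
      justified    : Justified earlier x reason
      run          : Run earlier
      shorter      : length earlier ℕ.< length σ
      recoloured-⊆ : recoloured earlier ⊆ recoloured σ

  justification : ∀ {σ x} → Run σ → x ∈ₛ recoloured σ → Justification σ x
  justification [] x∈∅ = ⊥-elim (∉⊥ x∈∅)
  justification {(v , _) ∷ σ} (j ∷ run) x∈ with x∈p∪q⁻ ⁅ v ⁆ (recoloured σ) x∈
  ... | inj₁ x∈⁅v⁆ rewrite x∈⁅y⁆⇒x≡y v x∈⁅v⁆ =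
    record { justified = j ; run = run ; shorter = ℕₚ.≤-refl ; recoloured-⊆ = q⊆p∪q ⁅ v ⁆ (recoloured σ) }
  ... | inj₂ x∈σ = record
    { justified = justified ; run = run′
    ; shorter = ℕₚ.≤-trans shorter (ℕₚ.n≤1+n _) ; recoloured-⊆ = q⊆p∪q ⁅ v ⁆ (recoloured σ) ∘ recoloured-⊆ }
    where
    open Justification (justification run x∈σ) renaming (run to run′)

  recoloured-InP : ∀ {σ x} → Run σ → x ∈ₛ recoloured σ → InP x
  recoloured-InP run x∈ = Justified.in-P (Justification.justified (justification run x∈))

  length≤∣recoloured∣ : ∀ {σ} → Run σ → length σ ℕ.≤ ∣ recoloured σ ∣
  length≤∣recoloured∣ [] = z≤n
  length≤∣recoloured∣ {(v , _) ∷ σ} (j ∷ run) =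
    ℕₚ.≤-<-trans (length≤∣recoloured∣ run)
      (p⊂q⇒∣p∣<∣q∣ (q⊆p∪q ⁅ v ⁆ (recoloured σ) , v , x∈p∪q⁺ (inj₁ (x∈⁅x⁆ v)) , justified-fresh j))

  length≤n : ∀ {σ} → Run σ → length σ ℕ.≤ n
  length≤n {σ} run = ℕₚ.≤-trans (length≤∣recoloured∣ run) (∣p∣≤n (recoloured σ))

module Rounds (n : ℕ) (p : ℚ) (t : Fin n → ℚ) (E : List (Subset n)) where
  open Arcs n p t
  open Procedure E
  open Runs n p t E

  colourIs : Color → Color → Bool
  colourIs blue = isBlue
  colourIs red  = isRed

  colourIs-sound : ∀ X {c} → T (colourIs X c) → c ≡ X
  colourIs-sound blue {blue} _ = refl
  colourIs-sound red  {red}  _ = refl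

  colourIs-refl : ∀ X → T (colourIs X X)
  colourIs-refl blue = _
  colourIs-refl red  = _

  allMono : Color → Coloring → Edge → Bool
  allMono X c f = all (λ v → colourIs X (c v)) (members f)

  allMono-sound : ∀ X {c f} → T (allMono X c f) → Mono X c f
  allMono-sound X {c} {f} h v∈f =
    colourIs-sound X (All.lookup (all⁺ (λ v → colourIs X (c v)) (members f) h) (∈-members⁺ v∈f))

  allMono-complete : ∀ X {c f} → Mono X c f → T (allMono X c f)
  allMono-complete X {c} mono = all⁻ (λ v → colourIs X (c v))
    (All.tabulate λ v∈ → subst (T ∘ colourIs X) (sym (mono (∈-members⁻ v∈))) (colourIs-refl X))

  lastIs-sound : ∀ {f b} → T (lastIs f b) → lastV f ≡ just b
  lastIs-sound {f} {b} h with lastV f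
  ... | just w with w ≟ b
  ...   | yes w≡b = cong just w≡b

  lastIs-complete : ∀ {f b} → lastV f ≡ just b → T (lastIs f b)
  lastIs-complete {b = b} last rewrite last = Equivalence.from T-≡ (dec-true (b ≟ b) refl)

  Fires : Color → Coloring → Fin n → Set
  Fires X c b = ∃ λ g → g ∈ E × lastV g ≡ just b × Mono X c g

  firing : Color → Coloring → Fin n → Edge → Bool
  firing X c b g = allMono X c g ∧ lastIs g b

  fires-sound : ∀ X {c b} → T (any (firing X c b) E) → Fires X c b
  fires-sound X {c} {b} h =
    let g , g∈E , fire = find (any⁻ (firing X c b) E h)
        mono , last = Equivalence.to T-∧ fire
    in g , g∈E , lastIs-sound last , allMono-sound X mono

  fires-complete : ∀ X {c b} → Fires X c b → T (any (firing X c b) E)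
  fires-complete X {c} {b} (g , g∈E , last , mono) =
    any⁺ (firing X c b) (lose g∈E (Equivalence.from T-∧ (allMono-complete X mono , lastIs-complete last)))

  -- stepB and stepR are step blue and step red, so body c is sweep red (sweep blue c).
  step : Color → Coloring → Fin n → Coloring
  step X c b = if any (firing X c b) E then update c b (opposite X) else c

  poleVertices : Color → List (Fin n)
  poleVertices X = sortBy t (filterᵇ (isReg (pole X)) (allFin n))

  sweep : Color → Coloring → Coloring
  sweep X c = foldl (step X) c (poleVertices X)

  step-view : ∀ X c b → (Fires X c b × step X c b ≡ update c b (opposite X)) ⊎ (¬ Fires X c b × step X c b ≡ c)
  step-view X c b = case ifᵈ-view (T? (any (firing X c b) E)) {update c b (opposite X)} {c} of λ where
    (inj₁ (fires , eq))  → inj₁ (fires-sound X fires , eq)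
    (inj₂ (¬fires , eq)) → inj₂ (¬fires ∘ fires-complete X , eq)

  ∈-poleVertices⁺ : ∀ {X b} → region (t b) ≡ pole X → b ∈ poleVertices X
  ∈-poleVertices⁺ {X} {b} e =
    ∈-resp-↭ (↭-sym (sortBy-↭ t _)) (∈-filterᵇ⁺ (isReg (pole X)) (∈-allFin b) (isReg-complete e))

  ∈-poleVertices⁻ : ∀ {X b} → b ∈ poleVertices X → region (t b) ≡ pole X
  ∈-poleVertices⁻ {X} b∈ = isReg-sound (∈-filterᵇ⁻ (isReg (pole X)) (allFin n) (∈-resp-↭ (sortBy-↭ t _) b∈))

  record Reached (k : ℕ) (c : Coloring) : Set where
    constructor reached
    field
      {history} : List Recolouring
      run       : Run history
      colours   : colouring history ≡ c
      k≤length  : k ℕ.≤ length history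

  Reached-weaken : ∀ {j k c} → j ℕ.≤ k → Reached k c → Reached j c
  Reached-weaken j≤k (reached run colours k≤) = reached run colours (ℕₚ.≤-trans j≤k k≤)

  recolour : ∀ {X k c b} → region (t b) ≡ pole X → Reached k c → Fires X c b →
             Reached (suc k) (update c b (opposite X))
  recolour {X} {b = b} pole-b (reached {σ} run refl k≤) (g , g∈E , last , mono) =
    reached (justified ∷ run) (cong (λ Y → update (colouring σ) b (opposite Y)) initial-b) (s≤s k≤)
    where
    initial-b : initial b ≡ X
    initial-b = initial-pole pole-b
    justified : Justified σ b g
    justified = record
      { in-P = pole⇒InP pole-b ; edge∈E = g∈E ; last = last ; mono = λ v∈g → trans (mono v∈g) (sym initial-b) }

  step-reached : ∀ {X k c b} → region (t b) ≡ pole X → Reached k c → Reached k (step X c b)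
  step-reached {X} {c = c} {b} pole-b r = case step-view X c b of λ where
    (inj₁ (fires , eq)) → subst (Reached _) (sym eq) (Reached-weaken (ℕₚ.n≤1+n _) (recolour pole-b r fires))
    (inj₂ (_ , eq))     → subst (Reached _) (sym eq) r

  steps-reached : ∀ {X k c} L → (∀ {b} → b ∈ L → region (t b) ≡ pole X) → Reached k c → Reached k (foldl (step X) c L)
  steps-reached []      _     r = r
  steps-reached (b ∷ L) poles r = steps-reached L (poles ∘ there) (step-reached (poles (here refl)) r)

  steps-progress : ∀ {X k c b} L → (∀ {b} → b ∈ L → region (t b) ≡ pole X) → Reached k c → b ∈ L → Fires X c b →
                   Reached (suc k) (foldl (step X) c L)
  steps-progress {X} {c = c} (b′ ∷ L) poles r b∈ fires = case step-view X c b′ , b∈ of λ where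
    (inj₁ (fires′ , eq) , _) →
      steps-reached L (poles ∘ there) (subst (Reached _) (sym eq) (recolour (poles (here refl)) r fires′))
    (inj₂ (¬fires , _) , here b≡b′) → ⊥-elim (¬fires (subst (Fires X c) b≡b′ fires))
    (inj₂ (_ , eq) , there b∈L) →
      subst (λ c′ → Reached _ (foldl (step X) c′ L)) (sym eq) (steps-progress L (poles ∘ there) r b∈L fires)

  step-keeps : ∀ {X c b g} → Mono (opposite X) c g → Mono (opposite X) (step X c b) g
  step-keeps {X} {c} {b} mono {y} y∈g = case step-view X c b of λ where
    (inj₁ (_ , eq)) → trans (cong-app eq y) (update-preserves c b (mono y∈g))
    (inj₂ (_ , eq)) → trans (cong-app eq y) (mono y∈g)

  steps-keep : ∀ {X c g} L → Mono (opposite X) c g → Mono (opposite X) (foldl (step X) c L) g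
  steps-keep []      mono = mono
  steps-keep (b ∷ L) mono = steps-keep L (step-keeps mono)

  sweep-reached : ∀ X {k c} → Reached k c → Reached k (sweep X c)
  sweep-reached X = steps-reached (poleVertices X) ∈-poleVertices⁻

  sweep-progress : ∀ X {k c b} → Reached k c → region (t b) ≡ pole X → Fires X c b → Reached (suc k) (sweep X c)
  sweep-progress X r pole-b = steps-progress (poleVertices X) ∈-poleVertices⁻ r (∈-poleVertices⁺ pole-b)

  sweep-keeps : ∀ X {c g} → Mono (opposite X) c g → Mono (opposite X) (sweep X c) g
  sweep-keeps X = steps-keep (poleVertices X)

  lastInPole : Color → Edge → Bool
  lastInPole blue = lastInPB
  lastInPole red  = lastInPR

  lastInPole-sound : ∀ X {f} → T (lastInPole X f) → ∃ λ w → lastV f ≡ just w × region (t w) ≡ pole X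
  lastInPole-sound blue {f} h with lastV f
  ... | just w = w , refl , isReg-sound h
  lastInPole-sound red  {f} h with lastV f
  ... | just w = w , refl , isReg-sound h

  lastInPole-complete : ∀ X {f w} → lastV f ≡ just w → region (t w) ≡ pole X → T (lastInPole X f)
  lastInPole-complete blue last e rewrite last = isReg-complete e
  lastInPole-complete red  last e rewrite last = isReg-complete e

  Pending : Coloring → Set
  Pending c = ∃₂ λ X w → region (t w) ≡ pole X × Fires X c w

  pending : ∀ X {c f} → f ∈ E → T (allMono X c f ∧ lastInPole X f) → Pending c
  pending X f∈E h =
    let mono , last = Equivalence.to T-∧ h
        w , lastV≡w , pole-w = lastInPole-sound X last
    in X , w , pole-w , _ , f∈E , lastV≡w , allMono-sound X mono

  guard-sound : ∀ {c} → T (guard c) → Pending c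
  guard-sound {c} h =
    let f , f∈E , h′ = find (any⁻ (λ f → (allBlue c f ∧ lastInPB f) ∨ (allRed c f ∧ lastInPR f)) E h)
    in [ pending blue f∈E , pending red f∈E ]′ (Equivalence.to T-∨ h′)

  guard-complete : ∀ {c} → Pending c → T (guard c)
  guard-complete {c} (X , w , pole-w , f , f∈E , last , mono) =
    any⁺ (λ f → (allBlue c f ∧ lastInPB f) ∨ (allRed c f ∧ lastInPR f)) (lose f∈E (Equivalence.from T-∨ (by-colour X fire)))
    where
    fire : T (allMono X c f ∧ lastInPole X f)
    fire = Equivalence.from T-∧ (allMono-complete X mono , lastInPole-complete X last pole-w)
    by-colour : ∀ Y → T (allMono Y c f ∧ lastInPole Y f) → T (allBlue c f ∧ lastInPB f) ⊎ T (allRed c f ∧ lastInPR f)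
    by-colour blue = inj₁
    by-colour red  = inj₂

  body-progress : ∀ {k c} → Reached k c → T (guard c) → Reached (suc k) (body c)
  body-progress {k} {c} r g = progress (guard-sound g)
    where
    progress : Pending c → Reached (suc k) (body c)
    progress (blue , w , pole-w , fires) = sweep-reached red (sweep-progress blue r pole-w fires)
    progress (red  , w , pole-w , (f , f∈E , last , mono)) =
      sweep-progress red (sweep-reached blue r) pole-w (f , f∈E , last , sweep-keeps blue mono)

  Halted : Coloring → Set
  Halted c = Reached 0 c × ¬ T (guard c)

  loop-halts : ∀ m {k c} → Reached k c → n ℕ.< m ℕ.+ k → Halted (loop m c)
  loop-halts zero r n<k = ⊥-elim (ℕₚ.<⇒≱ n<k (ℕₚ.≤-trans (Reached.k≤length r) (length≤n (Reached.run r))))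
  loop-halts (suc m) {k} {c} r n<m+k = [ continue , stop ]′ (ifᵈ-view (T? (guard c)) {loop m (body c)} {c})
    where
    continue : T (guard c) × _ ≡ loop m (body c) → Halted (loop (suc m) c)
    continue (g , eq) = subst Halted (sym eq) (loop-halts m (body-progress r g) (subst (n ℕ.<_) (sym (ℕₚ.+-suc m k)) n<m+k))
    stop : ¬ T (guard c) × _ ≡ c → Halted (loop (suc m) c)
    stop (¬g , eq) = subst Halted (sym eq) (Reached-weaken z≤n r , ¬g)

  MGC-halts : Halted MGC
  MGC-halts = loop-halts (suc n) (reached [] refl z≤n) (s≤s (ℕₚ.m≤m+n n 0))

module Correctness (n : ℕ) (E : List (Subset n)) (p : ℚ) (t : Fin n → ℚ)
  (0≤t<1 : ∀ v → 0ℚ ≤ t v × t v < 1ℚ)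
  (t-injective : ∀ u v → t u ≡ t v → u ≡ v)
  (nondegenerate : ∀ f → f ∈ E → ¬ Setup.Degenerate n p t f) where

  open Arcs n p t
  open Chains n p t E
  open Runs n p t E
  open Rounds n p t E

  mono⇒OnArc : ∀ {σ X f} → Run σ → f ∈ E → Mono X (colouring σ) f → OnArc X f
  mono⇒OnArc {σ} {X} {f} run f∈E mono = core-vertex (nondegenerate⇒InBR (nondegenerate f f∈E)) , avoids
    where
    avoids : ∀ {v} → v ∈ₛ f → region (t v) ≢ core (opposite X)
    avoids v∈f e = core⇒¬InP e (recoloured-InP run (recoloured-of-colour σ (mono v∈f) (initial-core e)))
    core-vertex : (∃ λ v → v ∈ₛ f × InBR v) → ∃ λ v → v ∈ₛ f × region (t v) ≡ core X
    core-vertex (v , v∈f , v∈BR) = [ (λ e → v , v∈f , e) , ⊥-elim ∘ avoids v∈f ]′ (InBR⇒core X v∈BR)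

  meets-only-at : ∀ {σ₁ σ₂ X f g u} → Run σ₂ → recoloured σ₁ ⊆ recoloured σ₂ →
                  Mono X (colouring σ₂) f → OnArc X f → firstV f ≡ just u →
                  Mono (opposite X) (colouring σ₁) g → OnArc (opposite X) g → lastV g ≡ just u →
                  region (t u) ≡ pole (opposite X) → f ∩ g ≡ ⁅ u ⁆
  meets-only-at {σ₁} {σ₂} {X} {u = u} run σ₁⊆σ₂ mono-f arc-f first mono-g arc-g last pole-u =
    ∩≡⁅⁆ (proj₁ u-first) (proj₁ u-last) common
    where
    u-first = firstV-minimal arc-f first
    u-last  = lastV-maximal arc-g last
    common : ∀ {x} → x ∈ₛ _ → x ∈ₛ _ → x ≡ u
    common {x} x∈f x∈g = t-injective x u (≤-antisym
        (arcKey-≤⇒t-≤ (opposite X) same (proj₂ u-last x∈g))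
        (arcKey-≤⇒t-≤ X (sym same) (proj₂ u-first x∈f)))
      where
      changed = recoloured-between {σ₁} {σ₂} σ₁⊆σ₂ λ eq →
        opposite-≢ X (trans (sym (mono-g x∈g)) (trans eq (mono-f x∈f)))
      same : region (t x) ≡ region (t u)
      same = trans (InP-initial⇒pole (recoloured-InP run (proj₂ changed)) (trans (sym (proj₁ changed)) (mono-g x∈g)))
                   (sym pole-u)

  record ChainFrom (σ : List Recolouring) (f : Edge) : Set where
    field
      chain            : Chain E
      starts           : Chain.s chain zero ≡ f
      alternating      : Alternating chain
      complete         : ∃ λ w → firstV (Chain.s chain (fromℕ (Chain.k chain))) ≡ just w × InBR w
      links-recoloured : ∀ i → Chain.v chain i ∈ₛ recoloured σ

  ChainsBefore : List Recolouring → Set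
  ChainsBefore σ = ∀ {σ′} → length σ′ ℕ.< length σ → Run σ′ →
                   ∀ {Y g} → g ∈ E → Mono Y (colouring σ′) g → ChainFrom σ′ g

  chainFrom-step : ∀ {σ} → ChainsBefore σ → Run σ → ∀ {X f} → f ∈ E → Mono X (colouring σ) f → ChainFrom σ f
  chainFrom-step {σ} before run {X} {f} f∈E mono =
    at-first (firstV-exists arc)
    where
    arc = mono⇒OnArc run f∈E mono

    ends-at : ∀ {u} → firstV f ≡ just u → region (t u) ≡ core X → ChainFrom σ f
    ends-at {u} first core-u = record
      { chain = singleton f∈E ; starts = refl
      ; alternating = singleton-alternating f∈E (OnArc⇒¬Easy arc) (nondegenerate f f∈E)
      ; complete = u , first , core⇒InBR core-u ; links-recoloured = λ () }

    extends-at : ∀ {u} → firstV f ≡ just u → region (t u) ≡ pole (opposite X) → ChainFrom σ f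
    extends-at {u} first pole-u = record
      { chain = cons f∈E C.chain f∩s₀ fresh ; starts = refl
      ; alternating = cons-alternating f∈E C.chain f∩s₀ fresh (OnArc⇒¬Easy arc) (nondegenerate f f∈E)
                        link (pole⇒InP pole-u) C.alternating
      ; complete = C.complete
      ; links-recoloured = λ { zero → u∈σ ; (suc i) → recoloured-⊆ (C.links-recoloured i) } }
      where
      initial-u = initial-pole pole-u
      u∈σ : u ∈ₛ recoloured σ
      u∈σ = recoloured-of-colour σ (mono (proj₁ (firstV-minimal arc first))) initial-u
      open Justification (justification run u∈σ) renaming (run to earlier-run)
      module J = Justified justified
      mono-g : Mono (opposite X) (colouring earlier) reason
      mono-g v∈g = trans (J.mono v∈g) initial-u
      module C = ChainFrom (before shorter earlier-run J.edge∈E mono-g)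
      link : lastV (Chain.s C.chain zero) ≡ firstV f
      link = trans (cong lastV C.starts) (trans J.last (sym first))
      f∩s₀ : f ∩ Chain.s C.chain zero ≡ ⁅ u ⁆
      f∩s₀ = subst (λ g → f ∩ g ≡ ⁅ u ⁆) (sym C.starts)
        (meets-only-at {earlier} {σ} run recoloured-⊆ mono arc first mono-g (mono⇒OnArc earlier-run J.edge∈E mono-g) J.last pole-u)
      fresh : ∀ i → Chain.v C.chain i ≢ u
      fresh i v≡u = justified-fresh justified (subst (_∈ₛ recoloured earlier) v≡u (C.links-recoloured i))

    at-first : (∃ λ u → firstV f ≡ just u) → ChainFrom σ f
    at-first (_ , first) = [ ends-at first , extends-at first ]′ (firstV-region arc first)

  chainFrom : ∀ {σ} → Acc ℕ._<_ (length σ) → Run σ → ∀ {X f} → f ∈ E → Mono X (colouring σ) f → ChainFrom σ f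
  chainFrom (acc before) = chainFrom-step (λ shorter → chainFrom (before shorter))

  chainFrom-reached : ∀ {k c X f} (r : Reached k c) → f ∈ E → Mono X c f → ChainFrom (Reached.history r) f
  chainFrom-reached (reached run colours _) f∈E mono =
    chainFrom (<-wellFounded _) run f∈E λ v∈f → trans (cong-app colours _) (mono v∈f)

  halted-lastV : ∀ {c X f} → Halted c → f ∈ E → Mono X c f → ∃ λ w → lastV f ≡ just w × InBR w
  halted-lastV {c} {X} {f} (reached run colours _ , halted) f∈E mono = at-last (lastV-exists arc)
    where
    arc = mono⇒OnArc run f∈E λ v∈f → trans (cong-app colours _) (mono v∈f)
    at-last : (∃ λ w → lastV f ≡ just w) → ∃ λ w → lastV f ≡ just w × InBR w
    at-last (w , last) = [ (λ core-w → w , last , core⇒InBR core-w)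
                         , (λ pole-w → ⊥-elim (halted (guard-complete (X , w , pole-w , f , f∈E , last , mono)))) ]′
                         (lastV-region 0≤t<1 arc last)

corollary9 : (n : ℕ) (E : List (Subset n)) (p : ℚ) (t : Fin n → ℚ)
    → 0ℚ < p → p < ½
    → (∀ v → 0ℚ ≤ t v × t v < 1ℚ)
    → (∀ u v → t u ≡ t v → u ≡ v)
    → (∀ f → f ∈ E → ¬ Setup.Degenerate n p t f)
    → (∀ (ch : Setup.Chain n p t E) → ¬ Setup.CompleteConflicting n p t ch)
    → Setup.Proper n p t E (Setup.Procedure.MGC n p t E)
corollary9 n E p t _ _ 0≤t<1 t-injective nondegenerate no-complete-conflicting f f∈E (X , mono) =
  let w , last , w∈BR = halted-lastV MGC-halts f∈E (mono _) in
  no-complete-conflicting chain ((alternating , w , trans (cong lastV starts) last , w∈BR) , complete)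
  where
  open Setup n p t using (lastV)
  open Correctness n E p t 0≤t<1 t-injective nondegenerate
  open Rounds n p t E using (MGC-halts)
  open ChainFrom (chainFrom-reached (proj₁ MGC-halts) f∈E (mono _))
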